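{- $\frac14\le\theta\le\frac38$.
   Context: For a connected graph $G$ with edge weights $w:E(G)\to\mathbb{R}_+$ (non-negative reals), $w(H)=\sum_{e\in E(H)}w(e)$ for a subgraph $H$, and $\mathrm{mac}(G)$ is the maximum total weight of the edges between $A$ and $B$ over all partitions $(A,B)$ of $V(G)$. A graph is triangle-free if it contains no $K_3$. $\theta$ is defined as the largest real number such that $\mathrm{mac}(G)\ge\frac{w(G)}{2}+\theta\, w(T)$ holds for every connected weighted triangle-free graph $G$ and every spanning tree $T$ of $G$.
   Formalization: The edge weights take values in the non-negative rationals instead of the non-negative reals, and the candidate values for θ in its defining maximum are rational. -}

module Defs where

open import Data.Bool using (Bool; true; false; _∧_; if_then_else_)
open import Data.Nat as ℕ using (ℕ; zero; suc)
open import Data.Fin using (Fin; toℕ)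
open import Data.List using (List; []; _∷_; map; concatMap; foldr; length)
open import Data.List.Relation.Unary.Unique.Propositional using (Unique)
open import Data.List.Relation.Unary.All using (All)
open import Data.Vec.Functional using () renaming (_∷_ to _∷ᵛ_)
open import Data.Fin.Base using (zero; suc)
open import Data.Integer using (+_)
open import Data.Rational using (ℚ; 0ℚ; _+_; _*_; _⊔_; _≤_; _/_)
open import Data.Product using (Σ; ∃; _×_; _,_)
open import Relation.Binary.PropositionalEquality using (_≡_; _≢_)
open import Relation.Nullary using (¬_)
open import Data.List using (allFin)

record Graph (n : ℕ) : Set where
  field
    adj     : Fin n → Fin n → Bool
    sym     : ∀ i j → adj i j ≡ adj j i
    irrefl  : ∀ i → adj i i ≡ false
open Graph public

Adj : ∀ {n} → Graph n → Fin n → Fin n → Set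
Adj G i j = adj G i j ≡ true

IsWalk : ∀ {n} → Graph n → List (Fin n) → Set
IsWalk G []            = Data.Unit.⊤ where import Data.Unit
IsWalk G (x ∷ [])      = Data.Unit.⊤ where import Data.Unit
IsWalk G (x ∷ y ∷ xs)  = Adj G x y × IsWalk G (y ∷ xs)

last : ∀ {A : Set} → A → List A → A
last a []       = a
last a (b ∷ bs) = last b bs

Connected : ∀ {n} → Graph n → Set
Connected {n} G = ∀ (u v : Fin n) →
  Σ (List (Fin n)) λ rest → IsWalk G (u ∷ rest) × last u rest ≡ v

IsCycle : ∀ {n} → Graph n → List (Fin n) → Set
IsCycle G []       = Data.Empty.⊥ where import Data.Empty
IsCycle G (v ∷ vs) =
  (2 ℕ.≤ length vs) × Unique (v ∷ vs) × IsWalk G (v ∷ vs) × Adj G (last v vs) v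

Acyclic : ∀ {n} → Graph n → Set
Acyclic {n} G = ∀ (c : List (Fin n)) → ¬ IsCycle G c

IsTree : ∀ {n} → Graph n → Set
IsTree G = Connected G × Acyclic G

Subgraph : ∀ {n} → Graph n → Graph n → Set
Subgraph {n} T G = ∀ (i j : Fin n) → Adj T i j → Adj G i j

SpanningTree : ∀ {n} → Graph n → Graph n → Set
SpanningTree T G = Subgraph T G × IsTree T

TriangleFree : ∀ {n} → Graph n → Set
TriangleFree {n} G = ∀ (a b c : Fin n) → ¬ (Adj G a b × Adj G b c × Adj G a c)

-- Edge weights.  A weight function assigns w i j to the edge {i,j};
-- only the values with toℕ i < toℕ j on edges are ever used.

Weight : ℕ → Set
Weight n = Fin n → Fin n → ℚ

NonNeg : ∀ {n} → Graph n → Weight n → Set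
NonNeg {n} G w = ∀ (i j : Fin n) → Adj G i j → 0ℚ ≤ w i j

sumℚ : List ℚ → ℚ
sumℚ = foldr _+_ 0ℚ

edgeSum : ∀ {n} → Graph n → (Fin n → Fin n → ℚ) → ℚ
edgeSum {n} H f =
  sumℚ (concatMap (λ i → map (λ j →
          if (adj H i j ∧ (toℕ i ℕ.<ᵇ toℕ j)) then f i j else 0ℚ)
        (allFin n)) (allFin n))

wt : ∀ {n} → Graph n → Weight n → ℚ
wt H w = edgeSum H w

-- Partitions (A,B) of V(G), given by the indicator of A.
Partition : ℕ → Set
Partition n = Fin n → Bool

allPartitions : (n : ℕ) → List (Partition n)
allPartitions zero    = (λ ()) ∷ []
allPartitions (suc n) =
  concatMap (λ s → (true ∷ᵛ s) ∷ (false ∷ᵛ s) ∷ []) (allPartitions n)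

differ : Bool → Bool → Bool
differ true  false = true
differ false true  = true
differ _     _     = false

cut : ∀ {n} → Graph n → Weight n → Partition n → ℚ
cut G w S = edgeSum G (λ i j → if differ (S i) (S j) then w i j else 0ℚ)

-- mac(G): maximum of cut over all 2^n partitions.  Starting the fold at 0
-- is harmless: the trivial partition (A = V, B = ∅) has cut 0.
mac : ∀ {n} → Graph n → Weight n → ℚ
mac G w = foldr (λ S m → cut G w S ⊔ m) 0ℚ (allPartitions _)

-- c is an admissible constant: mac(G) ≥ w(G)/2 + c·w(T) for every
-- connected weighted triangle-free graph G and spanning tree T of G.
-- θ is the largest admissible c.

Admissible : ℚ → Set
Admissible c =
  ∀ (n : ℕ) (G : Graph n) (w : Weight n) → NonNeg G w →
  Connected G → TriangleFree G →
  ∀ (T : Graph n) → SpanningTree T G →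
  (+ 1 / 2) * wt G w + c * wt T w ≤ mac G w

{-# OPTIONS --safe #-}
-- Lower bound: root the spanning tree T and call a vertex odd when its depth is odd.  Let one
-- map contract every odd vertex into its parent and another contract every even non-root
-- vertex into its parent; for each map r, choose S uniformly at random and put x on the side
-- S (r x) xor odd x.  If r merges the two ends of an edge of G, they are a vertex and its
-- parent (two children of one parent are never adjacent, since G is triangle-free), so the
-- ends have different parity and the edge is always cut; the other edges are cut with
-- probability 1/2.  Every tree edge is merged by one of the two maps, so the average of the
-- two random cuts is at least w(G)/2 + w(T)/4.  Expectations are written as sums over all
-- 2ⁿ partitions.
--
-- Upper bound: the 5-cycle with unit weights and a spanning path has w(G) = 5, w(T) = 4 and
-- mac(G) = 4.
module Submission where

open import Defs hiding (sym)
open import Data.Bool using (Bool; true; false; not; if_then_else_; _∧_; _∨_; _xor_; T)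
open import Data.Bool.Properties using (∨-zeroʳ; ∨-comm; ¬-not; not-distribˡ-xor) renaming (_≟_ to _≟ᵇ_)
open import Data.Fin using (Fin; zero; suc; toℕ)
open import Data.Fin.Properties using (any?; all?; toℕ-injective) renaming (_≟_ to _≟ᶠ_)
open import Data.List using (List; []; _∷_; length; _++_; map; concatMap; allFin; foldr; take; drop; reverse)
open import Data.List.Relation.Unary.All as All using (All; []; _∷_)
open import Data.List.Relation.Unary.All.Properties using (++⁺; ¬Any⇒All¬)
open import Data.List.Relation.Unary.Any as Any using (Any; here; there)
open import Data.List.Relation.Unary.AllPairs using ([]; _∷_)
open import Data.List.Relation.Unary.Unique.Propositional using (Unique)
open import Data.List.Membership.Propositional using (_∈_)
open import Data.Product using (Σ; _×_; _,_; proj₁; proj₂; uncurry)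
open import Data.Sum as Sum using (_⊎_; inj₁; inj₂)
open import Data.Unit using (tt)
open import Data.Empty using (⊥-elim)
open import Function using (_∘_)
open import Relation.Nullary using (¬_; Dec; yes; no; contradiction)
open import Relation.Nullary.Decidable using (does; dec-true; dec-false; toWitness; _×-dec_; _→-dec_; ¬?)
open import Relation.Binary.PropositionalEquality

Adj-sym : ∀ {n} (G : Graph n) {a b} → Adj G a b → Adj G b a
Adj-sym G {a} {b} = trans (Graph.sym G b a)

Adj-irrefl : ∀ {n} (G : Graph n) {a} → ¬ Adj G a a
Adj-irrefl G {a} e with trans (sym e) (irrefl G a)
... | ()

Adj⇒≢ : ∀ {n} (G : Graph n) {a b} → Adj G a b → b ≢ a
Adj⇒≢ G ab refl = Adj-irrefl G ab

IsWalk-++ : ∀ {n} (G : Graph n) a r b s →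
  IsWalk G (a ∷ r) → last a r ≡ b → IsWalk G (b ∷ s) → IsWalk G (a ∷ r ++ s)
IsWalk-++ G a []      b s _        refl ws = ws
IsWalk-++ G a (c ∷ r) b s (h , wr) e    ws = h , IsWalk-++ G c r b s wr e ws

last-++ : ∀ {A : Set} (a : A) r s b → last a r ≡ b → last a (r ++ s) ≡ last b s
last-++ a []      s b refl = refl
last-++ a (c ∷ r) s b e    = last-++ c r s b e

module _ {n} (G : Graph n) (Q : Fin n → Set) where

  SimpleWalk : Fin n → List (Fin n) → Set
  SimpleWalk a P = IsWalk G (a ∷ P) × Unique (a ∷ P) × All Q (a ∷ P)

  suffixAfter : ∀ {a b P} → a ∈ b ∷ P → List (Fin n)
  suffixAfter {P = P}     (here _)  = P
  suffixAfter {P = _ ∷ _} (there m) = suffixAfter m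

  SimpleWalk-suffix : ∀ {a b P} (m : a ∈ b ∷ P) →
    SimpleWalk b P → SimpleWalk a (suffixAfter m) × last a (suffixAfter m) ≡ last b P
  SimpleWalk-suffix (here refl) p = p , refl
  SimpleWalk-suffix {P = _ ∷ _} (there m) ((_ , w) , (_ ∷ u) , (_ ∷ q)) = SimpleWalk-suffix m (w , u , q)

  walk⇒simpleWalk : ∀ a W → IsWalk G (a ∷ W) → All Q (a ∷ W) →
    Σ (List (Fin n)) λ P → SimpleWalk a P × last a P ≡ last a W
  walk⇒simpleWalk a []      _       q = [] , (tt , [] ∷ [] , q) , refl
  walk⇒simpleWalk a (b ∷ W) (h , w) (qa ∷ q) with walk⇒simpleWalk b W w q
  ... | P , path@(wP , uP , qP) , lP with Any.any? (a ≟ᶠ_) (b ∷ P)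
  ...   | yes m = suffixAfter m , proj₁ (SimpleWalk-suffix m path) , trans (proj₂ (SimpleWalk-suffix m path)) lP
  ...   | no ¬m = b ∷ P , ((h , wP) , (¬Any⇒All¬ (b ∷ P) ¬m ∷ uP) , (qa ∷ qP)) , lP

IsWalk? : ∀ {n} (G : Graph n) xs → Dec (IsWalk G xs)
IsWalk? G []           = yes tt
IsWalk? G (x ∷ [])     = yes tt
IsWalk? G (x ∷ y ∷ xs) = (adj G x y ≟ᵇ true) ×-dec IsWalk? G (y ∷ xs)

Connected-mono : ∀ {n} {H G : Graph n} → Subgraph H G → Connected H → Connected G
Connected-mono {H = H} {G} H⊆G connected u v with connected u v
... | rest , w , l = rest , lift u rest w , l
  where
  lift : ∀ x xs → IsWalk H (x ∷ xs) → IsWalk G (x ∷ xs)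
  lift x []       _        = tt
  lift x (y ∷ xs) (xy , w) = H⊆G x y xy , lift y xs w

record Rooting {n} (T : Graph n) : Set where
  field
    root          : Fin n
    parent        : Fin n → Fin n
    odd           : Fin n → Bool
    parent-root   : parent root ≡ root
    odd-root      : odd root ≡ false
    parent-adj    : ∀ x → x ≢ root → Adj T (parent x) x
    odd-parent    : ∀ x → x ≢ root → odd x ≡ not (odd (parent x))
    edge-parent   : ∀ u v → Adj T u v → u ≡ parent v ⊎ v ≡ parent u

module RootedTrees where

  open import Data.Nat using (ℕ; zero; suc; _+_; _≤_; _<_; z≤n; s≤s; _≤′_; ≤′-refl; ≤′-step)
  open import Data.Nat.Properties
    using ( ≤-total; ≤-antisym; ≤-reflexive; <-≤-trans; <-irrefl; ≮⇒≥; ≤⇒≤′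
          ; n≤0⇒n≡0; n<1+n; m<n⇒m<1+n; m≤n⇒m≤1+n; +-suc)

  least : (ℕ → Bool) → ℕ → ℕ
  least f zero    = zero
  least f (suc b) with f zero
  ... | true  = zero
  ... | false = suc (least (λ k → f (suc k)) b)

  least-holds : ∀ (f : ℕ → Bool) b → f b ≡ true → f (least f b) ≡ true
  least-holds f zero    e = e
  least-holds f (suc b) e with f zero in eq
  ... | true  = eq
  ... | false = least-holds (λ k → f (suc k)) b e

  least-minimal : ∀ (f : ℕ → Bool) b k → k < least f b → f k ≡ false
  least-minimal f (suc b) k       lt with f zero in eq
  least-minimal f (suc b) zero    _         | false = eq
  least-minimal f (suc b) (suc k) (s≤s lt)  | false = least-minimal (λ k → f (suc k)) b k lt

  parity : ℕ → Bool
  parity zero    = false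
  parity (suc k) = not (parity k)

  ∧-true : ∀ {a b} → (a ∧ b) ≡ true → a ≡ true × b ≡ true
  ∧-true {true} {true} _ = refl , refl

  module BreadthFirstSearch {m} (T : Graph (suc m)) (connected : Connected T) where

    V : Set
    V = Fin (suc m)

    root : V
    root = zero

    reaches : ℕ → V → Bool
    reaches zero    zero    = true
    reaches zero    (suc _) = false
    reaches (suc k) x       = reaches k x ∨ does (any? (λ y → (reaches k y ∧ adj T y x) ≟ᵇ true))

    reached-neighbour? : ∀ k x → Dec (Σ V λ y → (reaches k y ∧ adj T y x) ≡ true)
    reached-neighbour? k x = any? (λ y → (reaches k y ∧ adj T y x) ≟ᵇ true)

    reaches-step : ∀ k {y x} → reaches k y ≡ true → Adj T y x → reaches (suc k) x ≡ true
    reaches-step k {y} {x} ry yx =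
      trans (cong (reaches k x ∨_) (dec-true (reached-neighbour? k x) (y , cong₂ _∧_ ry yx)))
            (∨-zeroʳ (reaches k x))

    reaches-mono : ∀ x {k l} → k ≤′ l → reaches k x ≡ true → reaches l x ≡ true
    reaches-mono x ≤′-refl       r = r
    reaches-mono x (≤′-step {l} k≤l) r = cong (_∨ does (reached-neighbour? l x)) (reaches-mono x k≤l r)

    reaches-last : ∀ k y rest → IsWalk T (y ∷ rest) → reaches k y ≡ true →
      reaches (length rest + k) (last y rest) ≡ true
    reaches-last k y []       _        r = r
    reaches-last k y (z ∷ rs) (yz , w) r =
      subst (λ l → reaches l (last z rs) ≡ true) (+-suc (length rs) k)
        (reaches-last (suc k) z rs w (reaches-step k r yz))

    reachable : ∀ x → Σ ℕ λ k → reaches k x ≡ true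
    reachable x with connected root x
    ... | rest , w , refl = length rest + 0 , reaches-last 0 root rest w refl

    depth : V → ℕ
    depth x = least (λ k → reaches k x) (proj₁ (reachable x))

    reaches-depth : ∀ x → reaches (depth x) x ≡ true
    reaches-depth x = least-holds (λ k → reaches k x) (proj₁ (reachable x)) (proj₂ (reachable x))

    below-depth : ∀ x {k} → k < depth x → reaches k x ≡ false
    below-depth x {k} = least-minimal (λ k → reaches k x) (proj₁ (reachable x)) k

    depth-minimal : ∀ x {k} → reaches k x ≡ true → depth x ≤ k
    depth-minimal x r = ≮⇒≥ λ k<depth → contradiction (trans (sym r) (below-depth x k<depth)) λ ()

    depth-root : depth root ≡ 0
    depth-root = n≤0⇒n≡0 (depth-minimal root refl)

    depth≡0⇒root : ∀ x → depth x ≡ 0 → x ≡ root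
    depth≡0⇒root x e = reaches₀ x (subst (λ k → reaches k x ≡ true) e (reaches-depth x))
      where
      reaches₀ : ∀ x → reaches 0 x ≡ true → x ≡ root
      reaches₀ zero _ = refl

    back : ℕ → V → V
    back k x with reached-neighbour? k x
    ... | yes (y , _) = y
    ... | no _        = root

    back-spec : ∀ k x → reaches (suc k) x ≡ true → reaches k x ≡ false →
      (reaches k (back k x) ∧ adj T (back k x) x) ≡ true
    back-spec k x r ¬r with reached-neighbour? k x
    ... | yes (_ , e) = e
    ... | no ∄y       =
      contradiction (trans (sym r) (cong₂ _∨_ ¬r (dec-false (reached-neighbour? k x) ∄y))) λ ()

    parentAt : ℕ → V → V
    parentAt zero    x = root
    parentAt (suc k) x = back k x

    parent : V → V
    parent x = parentAt (depth x) x

    parent-spec : ∀ x {k} → depth x ≡ suc k → Adj T (parent x) x × depth (parent x) ≡ k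
    parent-spec x {k} e rewrite e = yx , ≤-antisym (depth-minimal y ry) k≤dy
      where
      ¬rx : reaches k x ≡ false
      ¬rx = below-depth x (subst (k <_) (sym e) (n<1+n k))
      y : V
      y = back k x
      ry×yx : reaches k y ≡ true × Adj T y x
      ry×yx = ∧-true (back-spec k x (subst (λ l → reaches l x ≡ true) e (reaches-depth x)) ¬rx)
      ry : reaches k y ≡ true
      ry = proj₁ ry×yx
      yx : Adj T y x
      yx = proj₂ ry×yx
      k≤dy : k ≤ depth y
      k≤dy = ≮⇒≥ λ dy<k → contradiction
        (trans (sym (reaches-mono x (≤⇒≤′ dy<k) (reaches-step (depth y) (reaches-depth y) yx))) ¬rx) λ ()

    parent-root : parent root ≡ root
    parent-root = cong (λ k → parentAt k root) depth-root

    depth-nonroot : ∀ x → x ≢ root → Σ ℕ λ k → depth x ≡ suc k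
    depth-nonroot x x≢root with depth x in e
    ... | zero  = contradiction (depth≡0⇒root x e) x≢root
    ... | suc k = k , refl

    parent-adj : ∀ x → x ≢ root → Adj T (parent x) x
    parent-adj x x≢root = proj₁ (parent-spec x (proj₂ (depth-nonroot x x≢root)))

    depth-parent : ∀ x → x ≢ root → depth x ≡ suc (depth (parent x))
    depth-parent x x≢root with depth-nonroot x x≢root
    ... | k , e = trans e (cong suc (sym (proj₂ (parent-spec x e))))

    pathToRoot : ∀ x → Σ (List V) λ r →
      IsWalk T (x ∷ r) × last x r ≡ root × All (λ z → depth z < depth x) r
    pathToRoot x = go (depth x) x refl
      where
      go : ∀ k x → depth x ≡ k → Σ (List V) λ r →
        IsWalk T (x ∷ r) × last x r ≡ root × All (λ z → depth z < k) r
      go zero    x e = [] , tt , depth≡0⇒root x e , []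
      go (suc k) x e with parent-spec x e
      ... | px , dp with go k (parent x) dp
      ...   | r , w , l , below =
              parent x ∷ r , (Adj-sym T px , w) , l ,
              (subst (_< suc k) (sym dp) (n<1+n k) ∷ All.map m<n⇒m<1+n below)

    pathFromRoot : ∀ x → Σ (List V) λ r →
      IsWalk T (root ∷ r) × last root r ≡ x × All (λ z → depth z ≤ depth x) r
    pathFromRoot x = go (depth x) x refl
      where
      go : ∀ k x → depth x ≡ k → Σ (List V) λ r →
        IsWalk T (root ∷ r) × last root r ≡ x × All (λ z → depth z ≤ k) r
      go zero    x e = [] , tt , sym (depth≡0⇒root x e) , []
      go (suc k) x e with parent-spec x e
      ... | px , dp with go k (parent x) dp
      ...   | r , w , l , below =
              r ++ x ∷ [] , IsWalk-++ T root r (parent x) (x ∷ []) w l (px , tt) ,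
              last-++ root r (x ∷ []) (parent x) l ,
              ++⁺ (All.map m≤n⇒m≤1+n below) (≤-reflexive e ∷ [])

    shallower⇒≢ : ∀ {v z} → depth z < depth v → v ≢ z
    shallower⇒≢ lt refl = <-irrefl refl lt

    deeper-nonroot : ∀ {u v} → Adj T u v → depth u ≤ depth v → v ≢ root
    deeper-nonroot {u} uv du≤dv refl = Adj⇒≢ T uv (sym
      (depth≡0⇒root u (n≤0⇒n≡0 (subst (depth u ≤_) depth-root du≤dv))))

    -- up from u to the root, then down to parent v; every vertex after u is shallower than v
    path-avoiding : ∀ {u v} → Adj T u v → depth u ≤ depth v → v ≢ root →
      Σ (List V) λ P → SimpleWalk T (v ≢_) u P × last u P ≡ parent v
    path-avoiding {u} {v} uv du≤dv v≢root
      with r₁ , w₁ , l₁ , below₁ ← pathToRoot u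
      with r₂ , w₂ , l₂ , below₂ ← pathFromRoot (parent v)
      with P , path , l ← walk⇒simpleWalk T (v ≢_) u (r₁ ++ r₂) (IsWalk-++ T u r₁ root r₂ w₁ l₁ w₂)
             (Adj⇒≢ T uv ∷ ++⁺
               (All.map (λ lt → shallower⇒≢ (<-≤-trans lt du≤dv)) below₁)
               (All.map (λ le → shallower⇒≢ (subst (_ <_) (sym (depth-parent v v≢root)) (s≤s le))) below₂))
      = P , path , trans l (trans (last-++ u r₁ r₂ root l₁) l₂)

    -- otherwise the path avoiding v from u to parent v closes a cycle through v
    edge⇒parent : Acyclic T → ∀ {u v} → Adj T u v → depth u ≤ depth v → u ≡ parent v
    edge⇒parent acyclic {u} {v} uv du≤dv
      with v≢root ← deeper-nonroot uv du≤dv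
      with u ≟ᶠ parent v | path-avoiding uv du≤dv v≢root
    ... | yes u≡pv | _                           = u≡pv
    ... | no u≢pv  | []    , _                , l = contradiction l u≢pv
    ... | no _     | c ∷ P , (wP , uP , v≢P) , l =
          ⊥-elim (acyclic (v ∷ u ∷ c ∷ P)
            (s≤s (s≤s z≤n) , v≢P ∷ uP , (Adj-sym T uv , wP) ,
             subst (λ z → Adj T z v) (sym l) (parent-adj v v≢root)))

  tree-rooting : ∀ {m} {T : Graph (suc m)} → IsTree T → Rooting T
  tree-rooting {T = T} (connected , acyclic) = record
    { root          = root
    ; parent        = parent
    ; odd           = λ x → parity (depth x)
    ; parent-root   = parent-root
    ; odd-root      = cong parity depth-root
    ; parent-adj    = parent-adj
    ; odd-parent    = λ x x≢root → cong parity (depth-parent x x≢root)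
    ; edge-parent   = λ u v uv → Sum.map (edge⇒parent acyclic uv) (edge⇒parent acyclic (Adj-sym T uv))
                                         (≤-total (depth u) (depth v))
    }
    where open BreadthFirstSearch T connected

open RootedTrees using (tree-rooting)

module PathGraphs where

  open import Data.Nat using (ℕ; zero; suc; _+_; _≤_; _≡ᵇ_; s≤s)
  open import Data.Nat.Properties
    using ( ≡ᵇ⇒≡; suc-injective; ≤-trans; ≤-reflexive; n≤1+n; m≤n⇒m≤1+n; m≤n+m; m≤m+n; 1+n≰n
          ; +-suc; +-identityʳ)

  ≡ᵇ-suc : ∀ m → (m ≡ᵇ suc m) ≡ false
  ≡ᵇ-suc zero    = refl
  ≡ᵇ-suc (suc m) = ≡ᵇ-suc m

  path : ∀ n → Graph n
  path n = record
    { adj    = λ i j → (toℕ j ≡ᵇ suc (toℕ i)) ∨ (toℕ i ≡ᵇ suc (toℕ j))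
    ; sym    = λ i j → ∨-comm (toℕ j ≡ᵇ suc (toℕ i)) _
    ; irrefl = λ i → cong₂ _∨_ (≡ᵇ-suc (toℕ i)) (≡ᵇ-suc (toℕ i))
    }

  module _ {n : ℕ} where

    path-adj : ∀ {i j : Fin n} → Adj (path n) i j → toℕ j ≡ suc (toℕ i) ⊎ toℕ i ≡ suc (toℕ j)
    path-adj {i} {j} ij with toℕ j ≡ᵇ suc (toℕ i) in up
    ... | true  = inj₁ (≡ᵇ⇒≡ _ _ (subst T (sym up) tt))
    ... | false = inj₂ (≡ᵇ⇒≡ _ _ (subst T (sym ij) tt))

    path-near : ∀ {i j : Fin n} → Adj (path n) i j → toℕ i ≤ suc (toℕ j)
    path-near ij with path-adj ij
    ... | inj₁ j≡1+i = ≤-trans (m≤n⇒m≤1+n (n≤1+n _)) (≤-reflexive (cong suc (sym j≡1+i)))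
    ... | inj₂ i≡1+j = ≤-reflexive i≡1+j

    ascending : ∀ x y rest → IsWalk (path n) (y ∷ rest) → Unique (x ∷ y ∷ rest) →
      toℕ y ≡ suc (toℕ x) → toℕ (last y rest) ≡ length rest + toℕ y
    ascending x y []      _        _                     _      = refl
    ascending x y (z ∷ r) (yz , w) ((_ ∷ x≢z ∷ _) ∷ u) y≡1+x with path-adj yz
    ... | inj₁ z≡1+y = trans (ascending y z r w u z≡1+y)
                             (trans (cong (length r +_) z≡1+y) (+-suc (length r) (toℕ y)))
    ... | inj₂ y≡1+z = ⊥-elim (x≢z (toℕ-injective (suc-injective (trans (sym y≡1+x) y≡1+z))))

    descending : ∀ x y rest → IsWalk (path n) (y ∷ rest) → Unique (x ∷ y ∷ rest) →
      toℕ x ≡ suc (toℕ y) → toℕ (last y rest) + length rest ≡ toℕ y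
    descending x y []      _        _                     _      = +-identityʳ _
    descending x y (z ∷ r) (yz , w) ((_ ∷ x≢z ∷ _) ∷ u) x≡1+y with path-adj yz
    ... | inj₁ z≡1+y = ⊥-elim (x≢z (toℕ-injective (trans x≡1+y (sym z≡1+y))))
    ... | inj₂ y≡1+z = trans (+-suc (toℕ (last z r)) (length r))
                             (trans (cong suc (descending y z r w u y≡1+z)) (sym y≡1+z))

    -- a walk without repeated vertices in a path is monotone, so it never ends next to its start
    path-acyclic : Acyclic (path n)
    path-acyclic (_ ∷ _ ∷ [])    (s≤s () , _)
    path-acyclic (v ∷ y ∷ z ∷ r) (_ , uniq , (vy , w) , Lv) with path-adj vy
    ... | inj₁ y≡1+v = 1+n≰n (≤-trans above (path-near Lv))
      where
      above : suc (suc (toℕ v)) ≤ toℕ (last z r)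
      above = ≤-trans (s≤s (m≤n+m (suc (toℕ v)) (length r)))
        (≤-reflexive (sym (trans (ascending v y (z ∷ r) w uniq y≡1+v) (cong (suc (length r) +_) y≡1+v))))
    ... | inj₂ v≡1+y = 1+n≰n (≤-trans below (path-near (Adj-sym (path n) {last z r} Lv)))
      where
      L : ℕ
      L = toℕ (last z r)
      below : suc (suc L) ≤ toℕ v
      below = ≤-trans (s≤s (≤-trans (s≤s (m≤m+n L (length r))) (≤-reflexive (sym (+-suc L (length r))))))
        (≤-reflexive (sym (trans v≡1+y (cong suc (sym (descending v y (z ∷ r) w uniq v≡1+y))))))

open PathGraphs using (path; path-acyclic)

open import Data.Nat using (ℕ; zero; suc; _≡ᵇ_; _<ᵇ_; _%_)
open import Data.Vec.Functional using () renaming (_∷_ to _∷ᵛ_)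
open import Data.Rational
  using (ℚ; 0ℚ; 1ℚ; ½; -_; _+_; _*_; _/_; _≤_; _<_; _⊔_; Positive; NonNegative; positive)
open import Data.Rational.Properties
open import Data.Rational.Solver using (module +-*-Solver)
open import Data.List.Properties using (map-concatMap; concatMap-cong; map-∘; map-cong)
open import Data.List.Relation.Unary.Any.Properties using (concatMap⁺)
open import Algebra.Bundles using (CommutativeMonoid)
open import Algebra.Properties.CommutativeSemigroup
  (CommutativeMonoid.commutativeSemigroup +-0-commutativeMonoid) using (interchange)
open +-*-Solver using (solve; _:+_; _:*_; _:=_; :-_; con)

sumOver : {A : Set} → List A → (A → ℚ) → ℚ
sumOver xs f = sumℚ (map f xs)

sumOver-cong : ∀ {A : Set} xs {f g : A → ℚ} → (∀ x → f x ≡ g x) → sumOver xs f ≡ sumOver xs g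
sumOver-cong xs f≗g = cong sumℚ (map-cong f≗g xs)

sumOver-mono : ∀ {A : Set} xs {f g : A → ℚ} → (∀ x → f x ≤ g x) → sumOver xs f ≤ sumOver xs g
sumOver-mono []       f≤g = ≤-refl
sumOver-mono (x ∷ xs) f≤g = +-mono-≤ (f≤g x) (sumOver-mono xs f≤g)

sumOver-+ : ∀ {A : Set} xs (f g : A → ℚ) → sumOver xs (λ x → f x + g x) ≡ sumOver xs f + sumOver xs g
sumOver-+ []       f g = refl
sumOver-+ (x ∷ xs) f g = trans (cong (f x + g x +_) (sumOver-+ xs f g))
  (interchange (f x) (g x) (sumOver xs f) (sumOver xs g))

sumOver-* : ∀ {A : Set} xs c (f : A → ℚ) → sumOver xs (λ x → c * f x) ≡ c * sumOver xs f
sumOver-* []       c f = sym (*-zeroʳ c)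
sumOver-* (x ∷ xs) c f = trans (cong (c * f x +_) (sumOver-* xs c f)) (sym (*-distribˡ-+ c (f x) _))

sumOver-zero : ∀ {A : Set} (xs : List A) → sumOver xs (λ _ → 0ℚ) ≡ 0ℚ
sumOver-zero []       = refl
sumOver-zero (_ ∷ xs) = trans (+-identityˡ _) (sumOver-zero xs)

sumOver-swap : ∀ {A B : Set} (xs : List A) (ys : List B) (k : A → B → ℚ) →
  sumOver xs (λ x → sumOver ys (k x)) ≡ sumOver ys (λ y → sumOver xs (λ x → k x y))
sumOver-swap []       ys k = sym (sumOver-zero ys)
sumOver-swap (x ∷ xs) ys k = trans (cong (sumOver ys (k x) +_) (sumOver-swap xs ys k))
  (sym (sumOver-+ ys (k x) (λ y → sumOver xs (λ x → k x y))))

onEdge : ∀ {n} → Graph n → (Fin n → Fin n → ℚ) → Fin n → Fin n → ℚ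
onEdge H f i j = if adj H i j ∧ (toℕ i <ᵇ toℕ j) then f i j else 0ℚ

pairs : ∀ n → List (Fin n × Fin n)
pairs n = concatMap (λ i → map (i ,_) (allFin n)) (allFin n)

edgeSum-as-sumOver : ∀ {n} (H : Graph n) f → edgeSum H f ≡ sumOver (pairs n) (uncurry (onEdge H f))
edgeSum-as-sumOver {n} H f = cong sumℚ (sym (trans
  (map-concatMap (uncurry (onEdge H f)) (λ i → map (i ,_) (allFin n)) (allFin n))
  (concatMap-cong (λ i → sym (map-∘ (allFin n))) (allFin n))))

edgeSum-onEdge-cong : ∀ {n} (H K : Graph n) {f g} →
  (∀ i j → onEdge H f i j ≡ onEdge K g i j) → edgeSum H f ≡ edgeSum K g
edgeSum-onEdge-cong {n} _ _ e = cong sumℚ (concatMap-cong (λ i → map-cong (e i) (allFin n)) (allFin n))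

module _ {n} (H : Graph n) where

  open ≡-Reasoning

  private
    via : ∀ f → edgeSum H f ≡ sumOver (pairs n) (uncurry (onEdge H f))
    via = edgeSum-as-sumOver H

  edgeSum-cong : ∀ {f g} → (∀ i j → f i j ≡ g i j) → edgeSum H f ≡ edgeSum H g
  edgeSum-cong f≗g = edgeSum-onEdge-cong H H λ i j →
    cong (if adj H i j ∧ (toℕ i <ᵇ toℕ j) then_else 0ℚ) (f≗g i j)

  edgeSum-mono : ∀ {f g} → (∀ i j → Adj H i j → f i j ≤ g i j) → edgeSum H f ≤ edgeSum H g
  edgeSum-mono {f} {g} f≤g = subst₂ _≤_ (sym (via f)) (sym (via g))
    (sumOver-mono (pairs n) (uncurry onEdge-mono))
    where
    onEdge-mono : ∀ i j → onEdge H f i j ≤ onEdge H g i j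
    onEdge-mono i j with adj H i j in ij | toℕ i <ᵇ toℕ j
    ... | true  | true  = f≤g i j ij
    ... | true  | false = ≤-refl
    ... | false | _     = ≤-refl

  edgeSum-+ : ∀ f g → edgeSum H (λ i j → f i j + g i j) ≡ edgeSum H f + edgeSum H g
  edgeSum-+ f g = begin
    edgeSum H (λ i j → f i j + g i j)
      ≡⟨ via _ ⟩
    sumOver (pairs n) (uncurry (onEdge H (λ i j → f i j + g i j)))
      ≡⟨ sumOver-cong (pairs n) (λ (i , j) → if-0ℚ-+ (adj H i j ∧ (toℕ i <ᵇ toℕ j))) ⟩
    sumOver (pairs n) (λ (i , j) → onEdge H f i j + onEdge H g i j)
      ≡⟨ sumOver-+ (pairs n) (uncurry (onEdge H f)) (uncurry (onEdge H g)) ⟩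
    sumOver (pairs n) (uncurry (onEdge H f)) + sumOver (pairs n) (uncurry (onEdge H g))
      ≡⟨ cong₂ _+_ (via f) (via g) ⟨
    edgeSum H f + edgeSum H g
      ∎
    where
    if-0ℚ-+ : ∀ {x y} b → (if b then x + y else 0ℚ) ≡ (if b then x else 0ℚ) + (if b then y else 0ℚ)
    if-0ℚ-+ true  = refl
    if-0ℚ-+ false = refl

  edgeSum-* : ∀ c f → edgeSum H (λ i j → c * f i j) ≡ c * edgeSum H f
  edgeSum-* c f = begin
    edgeSum H (λ i j → c * f i j)
      ≡⟨ via _ ⟩
    sumOver (pairs n) (uncurry (onEdge H (λ i j → c * f i j)))
      ≡⟨ sumOver-cong (pairs n) (λ (i , j) → if-0ℚ-* (adj H i j ∧ (toℕ i <ᵇ toℕ j))) ⟩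
    sumOver (pairs n) (λ (i , j) → c * onEdge H f i j)
      ≡⟨ sumOver-* (pairs n) c (uncurry (onEdge H f)) ⟩
    c * sumOver (pairs n) (uncurry (onEdge H f))
      ≡⟨ cong (c *_) (via f) ⟨
    c * edgeSum H f
      ∎
    where
    if-0ℚ-* : ∀ {x} b → (if b then c * x else 0ℚ) ≡ c * (if b then x else 0ℚ)
    if-0ℚ-* true  = refl
    if-0ℚ-* false = sym (*-zeroʳ c)

  sumOver-edgeSum : ∀ {A : Set} (xs : List A) (F : A → Fin n → Fin n → ℚ) →
    sumOver xs (λ x → edgeSum H (F x)) ≡ edgeSum H (λ i j → sumOver xs (λ x → F x i j))
  sumOver-edgeSum xs F = begin
    sumOver xs (λ x → edgeSum H (F x))
      ≡⟨ sumOver-cong xs (λ x → via (F x)) ⟩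
    sumOver xs (λ x → sumOver (pairs n) (uncurry (onEdge H (F x))))
      ≡⟨ sumOver-swap xs (pairs n) (λ x → uncurry (onEdge H (F x))) ⟩
    sumOver (pairs n) (λ (i , j) → sumOver xs (λ x → onEdge H (F x) i j))
      ≡⟨ sumOver-cong (pairs n) (λ (i , j) → if-0ℚ-sumOver (adj H i j ∧ (toℕ i <ᵇ toℕ j))) ⟨
    sumOver (pairs n) (uncurry (onEdge H (λ i j → sumOver xs (λ x → F x i j))))
      ≡⟨ via _ ⟨
    edgeSum H (λ i j → sumOver xs (λ x → F x i j))
      ∎
    where
    if-0ℚ-sumOver : ∀ {i j} b → (if b then sumOver xs (λ x → F x i j) else 0ℚ) ≡
                                 sumOver xs (λ x → if b then F x i j else 0ℚ)
    if-0ℚ-sumOver true  = refl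
    if-0ℚ-sumOver false = sym (sumOver-zero xs)

edgeSum-subgraph : ∀ {n} {T G : Graph n} → Subgraph T G → ∀ f →
  edgeSum T f ≡ edgeSum G (λ i j → if adj T i j then f i j else 0ℚ)
edgeSum-subgraph {n} {T} {G} T⊆G f = edgeSum-onEdge-cong T G restrict
  where
  restrict : ∀ i j → onEdge T f i j ≡ onEdge G (λ i j → if adj T i j then f i j else 0ℚ) i j
  restrict i j with adj T i j in ij
  ... | true  rewrite T⊆G i j ij = refl
  ... | false with adj G i j ∧ (toℕ i <ᵇ toℕ j)
  ...   | true  = refl
  ...   | false = refl

sumParts : ∀ n → (Partition n → ℚ) → ℚ
sumParts n = sumOver (allPartitions n)

sumParts-suc : ∀ n F → sumParts (suc n) F ≡ sumParts n (λ s → F (true ∷ᵛ s) + F (false ∷ᵛ s))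
sumParts-suc n F = go (allPartitions n)
  where
  go : ∀ ss → sumOver (concatMap (λ s → (true ∷ᵛ s) ∷ (false ∷ᵛ s) ∷ []) ss) F ≡
              sumOver ss (λ s → F (true ∷ᵛ s) + F (false ∷ᵛ s))
  go []       = refl
  go (s ∷ ss) = trans (cong (λ z → F (true ∷ᵛ s) + (F (false ∷ᵛ s) + z)) (go ss))
                      (sym (+-assoc (F (true ∷ᵛ s)) (F (false ∷ᵛ s)) _))

#partitions : ℕ → ℚ
#partitions zero    = 1ℚ
#partitions (suc n) = #partitions n + #partitions n

#partitions-pos : ∀ n → 0ℚ < #partitions n
#partitions-pos zero    = positive⁻¹ 1ℚ
#partitions-pos (suc n) = +-mono-< (#partitions-pos n) (#partitions-pos n)

private
  doubling : ∀ N x → N * x + N * x ≡ (N + N) * x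
  doubling N x = sym (*-distribʳ-+ x N N)

sumParts-const : ∀ n c → sumParts n (λ _ → c) ≡ #partitions n * c
sumParts-const zero    c = trans (+-identityʳ c) (sym (*-identityˡ c))
sumParts-const (suc n) c = begin
  sumParts (suc n) (λ _ → c)       ≡⟨ sumParts-suc n (λ _ → c) ⟩
  sumParts n (λ _ → c + c)         ≡⟨ sumParts-const n (c + c) ⟩
  #partitions n * (c + c)          ≡⟨ *-distribˡ-+ (#partitions n) c c ⟩
  #partitions n * c + #partitions n * c ≡⟨ doubling (#partitions n) c ⟩
  #partitions (suc n) * c          ∎
  where open ≡-Reasoning

sumParts-bit : ∀ n b (k : Bool → ℚ) →
  sumParts n (λ S → k (S b)) + sumParts n (λ S → k (S b)) ≡ #partitions n * (k true + k false)
sumParts-bit (suc n) zero k = begin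
  sumParts (suc n) (λ S → k (S zero)) + sumParts (suc n) (λ S → k (S zero))
    ≡⟨ cong (λ x → x + x) (trans (sumParts-suc n _) (sumParts-const n (k true + k false))) ⟩
  #partitions n * (k true + k false) + #partitions n * (k true + k false)
    ≡⟨ doubling (#partitions n) _ ⟩
  #partitions (suc n) * (k true + k false)
    ∎
  where open ≡-Reasoning
sumParts-bit (suc n) (suc b) k = begin
  sumParts (suc n) (λ S → k (S (suc b))) + sumParts (suc n) (λ S → k (S (suc b)))
    ≡⟨ cong (λ x → x + x) (trans (sumParts-suc n _) (sumOver-+ (allPartitions n) kb kb)) ⟩
  (X + X) + (X + X)
    ≡⟨ cong (λ x → x + x) (sumParts-bit n b k) ⟩
  #partitions n * (k true + k false) + #partitions n * (k true + k false)
    ≡⟨ doubling (#partitions n) _ ⟩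
  #partitions (suc n) * (k true + k false)
    ∎
  where
  open ≡-Reasoning
  kb : Partition n → ℚ
  kb S = k (S b)
  X : ℚ
  X = sumParts n kb

sumParts-two-bits : ∀ n {a b} → a ≢ b → (h : Bool → Bool → ℚ) {c : ℚ} →
  (∀ x y → h x y + h x (not y) ≡ c) →
  sumParts n (λ S → h (S a) (S b)) + sumParts n (λ S → h (S a) (S b)) ≡ #partitions n * c
sumParts-two-bits (suc n) {zero} {zero} a≢b h hc = ⊥-elim (a≢b refl)
sumParts-two-bits (suc n) {zero} {suc b} a≢b h {c} hc = begin
  sumParts (suc n) (λ S → h (S zero) (S (suc b))) + sumParts (suc n) (λ S → h (S zero) (S (suc b)))
    ≡⟨ cong (λ x → x + x) (sumParts-suc n _) ⟩
  sumParts n (λ S → k (S b)) + sumParts n (λ S → k (S b))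
    ≡⟨ sumParts-bit n b k ⟩
  #partitions n * (k true + k false)
    ≡⟨ cong (#partitions n *_) (trans (interchange (h true true) (h false true) (h true false) (h false false))
                                      (cong₂ _+_ (hc true true) (hc false true))) ⟩
  #partitions n * (c + c)
    ≡⟨ trans (*-distribˡ-+ (#partitions n) c c) (doubling (#partitions n) c) ⟩
  #partitions (suc n) * c
    ∎
  where
  open ≡-Reasoning
  k : Bool → ℚ
  k y = h true y + h false y
sumParts-two-bits (suc n) {suc a} {zero} a≢b h {c} hc = begin
  sumParts (suc n) (λ S → h (S (suc a)) (S zero)) + sumParts (suc n) (λ S → h (S (suc a)) (S zero))
    ≡⟨ cong (λ x → x + x) (trans (sumParts-suc n _) (trans (sumOver-cong (allPartitions n) (λ s → hc (s a) true))
                                                           (sumParts-const n c))) ⟩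
  #partitions n * c + #partitions n * c
    ≡⟨ doubling (#partitions n) c ⟩
  #partitions (suc n) * c
    ∎
  where open ≡-Reasoning
sumParts-two-bits (suc n) {suc a} {suc b} a≢b h {c} hc = begin
  sumParts (suc n) (λ S → h (S (suc a)) (S (suc b))) + sumParts (suc n) (λ S → h (S (suc a)) (S (suc b)))
    ≡⟨ cong (λ x → x + x) (trans (sumParts-suc n _) (sumOver-+ (allPartitions n) H H)) ⟩
  (sumParts n H + sumParts n H) + (sumParts n H + sumParts n H)
    ≡⟨ cong (λ x → x + x) (sumParts-two-bits n (a≢b ∘ cong suc) h hc) ⟩
  #partitions n * c + #partitions n * c
    ≡⟨ doubling (#partitions n) c ⟩
  #partitions (suc n) * c
    ∎
  where
  open ≡-Reasoning
  H : Partition n → ℚ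
  H s = h (s a) (s b)

allPartitions-complete : ∀ n (S : Partition n) → Any (λ S′ → ∀ i → S′ i ≡ S i) (allPartitions n)
allPartitions-complete zero    S = here λ ()
allPartitions-complete (suc n) S = concatMap⁺ (λ s → (true ∷ᵛ s) ∷ (false ∷ᵛ s) ∷ [])
  (Any.map extend (allPartitions-complete n (S ∘ suc)))
  where
  extend : ∀ {s} → (∀ i → s i ≡ S (suc i)) →
    Any (λ S′ → ∀ i → S′ i ≡ S i) ((true ∷ᵛ s) ∷ (false ∷ᵛ s) ∷ [])
  extend s≗ with S zero in e
  ... | true  = here        λ { zero → sym e ; (suc i) → s≗ i }
  ... | false = there (here λ { zero → sym e ; (suc i) → s≗ i })

≤-foldr-⊔ : ∀ {A : Set} (F : A → ℚ) {y} xs → Any (λ x → y ≤ F x) xs →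
  y ≤ foldr (λ x m → F x ⊔ m) 0ℚ xs
≤-foldr-⊔ F (x ∷ xs) (here y≤Fx) = ≤-trans y≤Fx (p≤p⊔q (F x) _)
≤-foldr-⊔ F (x ∷ xs) (there y≤)  = ≤-trans (≤-foldr-⊔ F xs y≤) (p≤q⊔p (F x) _)

cut-cong : ∀ {n} (G : Graph n) w {S S′ : Partition n} → (∀ i → S i ≡ S′ i) → cut G w S ≡ cut G w S′
cut-cong G w S≗S′ = edgeSum-cong G λ i j →
  cong₂ (λ a b → if differ a b then w i j else 0ℚ) (S≗S′ i) (S≗S′ j)

cut≤mac : ∀ {n} (G : Graph n) w S → cut G w S ≤ mac G w
cut≤mac {n} G w S = ≤-foldr-⊔ (cut G w) (allPartitions n)
  (Any.map (λ S′≗S → ≤-reflexive (cut-cong G w (sym ∘ S′≗S))) (allPartitions-complete n S))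

sumParts-cut≤ : ∀ {n} (G : Graph n) w (F : Partition n → Partition n) →
  sumParts n (λ S → cut G w (F S)) ≤ #partitions n * mac G w
sumParts-cut≤ {n} G w F = subst (sumParts n (λ S → cut G w (F S)) ≤_) (sumParts-const n (mac G w))
  (sumOver-mono (allPartitions n) (λ S → cut≤mac G w (F S)))

half-≤ : ∀ {a} b → a ≤ b + b → ½ * a ≤ b
half-≤ {a} b a≤2b = subst (½ * a ≤_) (solve 1 (λ b → con ½ :* (b :+ b) := b) refl b)
  (*-monoˡ-≤-nonNeg ½ a≤2b)

tree-edge-bound : ∀ N w x y → x ≡ N * w → N * w ≤ y + y → N * (w + ½ * w) ≤ x + y
tree-edge-bound N w x y x≡Nw Nw≤2y = begin
  N * (w + ½ * w)
    ≡⟨ solve 2 (λ N w → N :* (w :+ con ½ :* w) := N :* w :+ con ½ :* (N :* w)) refl N w ⟩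
  N * w + ½ * (N * w)
    ≤⟨ +-mono-≤ (≤-reflexive (sym x≡Nw)) (half-≤ y Nw≤2y) ⟩
  x + y
    ∎
  where open ≤-Reasoning

non-tree-edge-bound : ∀ N w x y → N * w ≤ x + x → N * w ≤ y + y → N * (w + ½ * 0ℚ) ≤ x + y
non-tree-edge-bound N w x y Nw≤2x Nw≤2y = begin
  N * (w + ½ * 0ℚ)
    ≡⟨ solve 2 (λ N w → N :* (w :+ con ½ :* con 0ℚ) := con ½ :* (N :* w) :+ con ½ :* (N :* w)) refl N w ⟩
  ½ * (N * w) + ½ * (N * w)
    ≤⟨ +-mono-≤ (half-≤ x Nw≤2x) (half-≤ y Nw≤2y) ⟩
  x + y
    ∎
  where open ≤-Reasoning

differ-xor-not : ∀ s a → differ (s xor not a) (s xor a) ≡ true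
differ-xor-not false false = refl
differ-xor-not false true  = refl
differ-xor-not true  false = refl
differ-xor-not true  true  = refl

if-differ-not : ∀ p q (x : ℚ) → (if differ p q then x else 0ℚ) + (if differ p (not q) then x else 0ℚ) ≡ x
if-differ-not false false x = +-identityˡ x
if-differ-not false true  x = +-identityʳ x
if-differ-not true  false x = +-identityʳ x
if-differ-not true  true  x = +-identityˡ x

module RandomCuts {n} (G : Graph n) (w : Weight n) (odd : Fin n → Bool) where

  N : ℚ
  N = #partitions n

  instance
    N-positive : Positive N
    N-positive = positive (#partitions-pos n)

    N-nonNegative : NonNegative N
    N-nonNegative = pos⇒nonNeg N

  twist : (Fin n → Fin n) → Partition n → Partition n
  twist r S x = S (r x) xor odd x

  cutWeight : Partition n → Fin n → Fin n → ℚ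
  cutWeight S i j = if differ (S i) (S j) then w i j else 0ℚ

  summedCut : (Fin n → Fin n) → Fin n → Fin n → ℚ
  summedCut r i j = sumParts n (λ S → cutWeight (twist r S) i j)

  summedCut-merged : ∀ r {i j} → r i ≡ r j → odd i ≢ odd j → summedCut r i j ≡ N * w i j
  summedCut-merged r {i} {j} ri≡rj odd≢ =
    trans (sumOver-cong (allPartitions n) always-cut) (sumParts-const n (w i j))
    where
    always-cut : ∀ S → cutWeight (twist r S) i j ≡ w i j
    always-cut S rewrite ri≡rj | ¬-not odd≢ | differ-xor-not (S (r j)) (odd j) = refl

  summedCut-apart : ∀ r {i j} → r i ≢ r j → summedCut r i j + summedCut r i j ≡ N * w i j
  summedCut-apart r {i} {j} ri≢rj = sumParts-two-bits n ri≢rj h h-flip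
    where
    h : Bool → Bool → ℚ
    h x y = if differ (x xor odd i) (y xor odd j) then w i j else 0ℚ
    h-flip : ∀ x y → h x y + h x (not y) ≡ w i j
    h-flip x y rewrite sym (not-distribˡ-xor y (odd j)) = if-differ-not (x xor odd i) (y xor odd j) (w i j)

  MergesBichromatic : (Fin n → Fin n) → Set
  MergesBichromatic r = ∀ i j → Adj G i j → r i ≡ r j → odd i ≢ odd j

  summedCut-half : ∀ r → MergesBichromatic r → NonNeg G w → ∀ i j → Adj G i j →
    N * w i j ≤ summedCut r i j + summedCut r i j
  summedCut-half r bichromatic w≥0 i j ij with r i ≟ᶠ r j
  ... | no ri≢rj = ≤-reflexive (sym (summedCut-apart r ri≢rj))
  ... | yes ri≡rj rewrite summedCut-merged r ri≡rj (bichromatic i j ij ri≡rj) =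
    subst (_≤ N * w i j + N * w i j) (+-identityʳ (N * w i j)) (+-monoʳ-≤ (N * w i j) Nw≥0)
    where
    Nw≥0 : 0ℚ ≤ N * w i j
    Nw≥0 = subst (_≤ N * w i j) (*-zeroʳ N) (*-monoˡ-≤-nonNeg N (w≥0 i j ij))

module RootedCuts {n} (G T : Graph n) (w : Weight n) (T⊆G : Subgraph T G) (ρ : Rooting T) where
  open Rooting ρ
  open RandomCuts G w odd

  contractOdd : Fin n → Fin n
  contractOdd x = if odd x then parent x else x

  contractEven : Fin n → Fin n
  contractEven x = if odd x then x else parent x

  odd⇒nonroot : ∀ {x} → odd x ≡ true → x ≢ root
  odd⇒nonroot ox refl with trans (sym ox) odd-root
  ... | ()

  distinct-parents : TriangleFree G → ∀ {i j} → Adj G i j → i ≢ root → j ≢ root → parent i ≢ parent j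
  distinct-parents tf {i} {j} ij i≢root j≢root pi≡pj =
    tf i j (parent j) (ij , Adj-sym G (T⊆G _ _ (parent-adj j j≢root)) ,
                       T⊆G _ _ (Adj-sym T (subst (λ p → Adj T p i) pi≡pj (parent-adj i i≢root))))

  contractOdd-bichromatic : TriangleFree G → MergesBichromatic contractOdd
  contractOdd-bichromatic tf i j ij with odd i in oi | odd j in oj
  ... | false | false = λ i≡j _ → Adj⇒≢ G ij (sym i≡j)
  ... | true  | true  = λ pi≡pj _ → distinct-parents tf ij (odd⇒nonroot oi) (odd⇒nonroot oj) pi≡pj
  ... | false | true  = λ _ ()
  ... | true  | false = λ _ ()

  even-child-of-root : ∀ {x} → odd x ≡ false → parent x ≡ root → x ≡ root
  even-child-of-root {x} ox px≡root with x ≟ᶠ root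
  ... | yes x≡root = x≡root
  ... | no  x≢root = contradiction
        (trans (sym ox) (trans (odd-parent x x≢root) (cong not (trans (cong odd px≡root) odd-root))))
        λ ()

  even-distinct-parents : TriangleFree G → ∀ {i j} → Adj G i j → odd i ≡ false → odd j ≡ false →
    parent i ≢ parent j
  even-distinct-parents tf {i} {j} ij oi oj pi≡pj with i ≟ᶠ root | j ≟ᶠ root
  ... | yes i≡root | _ = Adj⇒≢ G ij
        (trans (even-child-of-root oj (trans (sym pi≡pj) (trans (cong parent i≡root) parent-root))) (sym i≡root))
  ... | _ | yes j≡root = Adj⇒≢ G ij
        (trans j≡root (sym (even-child-of-root oi (trans pi≡pj (trans (cong parent j≡root) parent-root)))))
  ... | no i≢root | no j≢root = distinct-parents tf ij i≢root j≢root pi≡pj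

  contractEven-bichromatic : TriangleFree G → MergesBichromatic contractEven
  contractEven-bichromatic tf i j ij with odd i in oi | odd j in oj
  ... | true  | true  = λ i≡j _ → Adj⇒≢ G ij (sym i≡j)
  ... | false | false = λ pi≡pj _ → even-distinct-parents tf ij oi oj pi≡pj
  ... | false | true  = λ _ ()
  ... | true  | false = λ _ ()

  parent-edge-contracted : ∀ x → x ≢ root →
    contractOdd (parent x) ≡ contractOdd x ⊎ contractEven (parent x) ≡ contractEven x
  parent-edge-contracted x x≢root with odd x | odd (parent x) | odd-parent x x≢root
  ... | true  | false | _  = inj₁ refl
  ... | false | true  | _  = inj₂ refl
  ... | true  | true  | ()
  ... | false | false | ()

  child-nonroot : ∀ {x} → Adj T (parent x) x → x ≢ root
  child-nonroot {x} px-x x≡root =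
    Adj⇒≢ T px-x (trans x≡root (sym (trans (cong parent x≡root) parent-root)))

  tree-edge-contracted : ∀ {i j} → Adj T i j →
    contractOdd i ≡ contractOdd j ⊎ contractEven i ≡ contractEven j
  tree-edge-contracted {i} {j} ij with edge-parent i j ij
  ... | inj₁ refl = parent-edge-contracted j (child-nonroot ij)
  ... | inj₂ refl = Sum.map sym sym (parent-edge-contracted i (child-nonroot (Adj-sym T ij)))

  treeWeight : Fin n → Fin n → ℚ
  treeWeight i j = if adj T i j then w i j else 0ℚ

  edge-bound : TriangleFree G → NonNeg G w → ∀ i j → Adj G i j →
    N * (w i j + ½ * treeWeight i j) ≤ summedCut contractOdd i j + summedCut contractEven i j
  edge-bound tf w≥0 i j ij with adj T i j in ijT
  ... | false = non-tree-edge-bound N (w i j) (summedCut contractOdd i j) (summedCut contractEven i j)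
                  (half contractOdd (contractOdd-bichromatic tf))
                  (half contractEven (contractEven-bichromatic tf))
    where
    half : ∀ r → MergesBichromatic r → N * w i j ≤ summedCut r i j + summedCut r i j
    half r bichromatic = summedCut-half r bichromatic w≥0 i j ij
  ... | true with tree-edge-contracted ijT
  ...   | inj₁ merged = tree-edge-bound N (w i j) (summedCut contractOdd i j) (summedCut contractEven i j)
          (summedCut-merged contractOdd merged (contractOdd-bichromatic tf i j ij merged))
          (summedCut-half contractEven (contractEven-bichromatic tf) w≥0 i j ij)
  ...   | inj₂ merged = subst (_ ≤_) (+-comm (summedCut contractEven i j) (summedCut contractOdd i j))
          (tree-edge-bound N (w i j) (summedCut contractEven i j) (summedCut contractOdd i j)
          (summedCut-merged contractEven merged (contractEven-bichromatic tf i j ij merged))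
          (summedCut-half contractOdd (contractOdd-bichromatic tf) w≥0 i j ij))

  summedCut-lower-bound : TriangleFree G → NonNeg G w →
    N * (wt G w + ½ * wt T w) ≤
    sumParts n (λ S → cut G w (twist contractOdd S)) + sumParts n (λ S → cut G w (twist contractEven S))
  summedCut-lower-bound tf w≥0 = begin
    N * (wt G w + ½ * wt T w)
      ≡⟨ cong (λ t → N * (wt G w + ½ * t)) (edgeSum-subgraph {T = T} {G = G} T⊆G w) ⟩
    N * (edgeSum G w + ½ * edgeSum G treeWeight)
      ≡⟨ cong (λ t → N * (edgeSum G w + t)) (edgeSum-* G ½ treeWeight) ⟨
    N * (edgeSum G w + edgeSum G (λ i j → ½ * treeWeight i j))
      ≡⟨ cong (N *_) (edgeSum-+ G w _) ⟨
    N * edgeSum G (λ i j → w i j + ½ * treeWeight i j)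
      ≡⟨ edgeSum-* G N _ ⟨
    edgeSum G (λ i j → N * (w i j + ½ * treeWeight i j))
      ≤⟨ edgeSum-mono G (edge-bound tf w≥0) ⟩
    edgeSum G (λ i j → summedCut contractOdd i j + summedCut contractEven i j)
      ≡⟨ edgeSum-+ G (summedCut contractOdd) (summedCut contractEven) ⟩
    edgeSum G (summedCut contractOdd) + edgeSum G (summedCut contractEven)
      ≡⟨ cong₂ _+_ (sumOver-edgeSum G (allPartitions n) (λ S → cutWeight (twist contractOdd S)))
                   (sumOver-edgeSum G (allPartitions n) (λ S → cutWeight (twist contractEven S))) ⟨
    sumParts n (λ S → cut G w (twist contractOdd S)) + sumParts n (λ S → cut G w (twist contractEven S))
      ∎
    where open ≤-Reasoning

  mac-lower-bound : TriangleFree G → NonNeg G w → wt G w + ½ * wt T w ≤ mac G w + mac G w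
  mac-lower-bound tf w≥0 = *-cancelˡ-≤-pos N (begin
    N * (wt G w + ½ * wt T w)
      ≤⟨ summedCut-lower-bound tf w≥0 ⟩
    sumParts n (λ S → cut G w (twist contractOdd S)) + sumParts n (λ S → cut G w (twist contractEven S))
      ≤⟨ +-mono-≤ (sumParts-cut≤ G w (twist contractOdd)) (sumParts-cut≤ G w (twist contractEven)) ⟩
    N * mac G w + N * mac G w
      ≡⟨ *-distribˡ-+ N (mac G w) (mac G w) ⟨
    N * (mac G w + mac G w)
      ∎)
    where open ≤-Reasoning

cycle₅-adj : Fin 5 → Fin 5 → Bool
cycle₅-adj i j = (toℕ j ≡ᵇ suc (toℕ i) % 5) ∨ (toℕ i ≡ᵇ suc (toℕ j) % 5)

cycle₅ : Graph 5
cycle₅ = record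
  { adj    = cycle₅-adj
  ; sym    = λ i j → ∨-comm (toℕ j ≡ᵇ suc (toℕ i) % 5) _
  ; irrefl = toWitness {a? = all? λ i → cycle₅-adj i i ≟ᵇ false} tt
  }

cycle₅-triangleFree : TriangleFree cycle₅
cycle₅-triangleFree = toWitness {a? = all? λ a → all? λ b → all? λ c →
  ¬? ((cycle₅-adj a b ≟ᵇ true) ×-dec (cycle₅-adj b c ≟ᵇ true) ×-dec (cycle₅-adj a c ≟ᵇ true))} tt

path₅⊆cycle₅ : Subgraph (path 5) cycle₅
path₅⊆cycle₅ = toWitness {a? = all? λ i → all? λ j →
  (adj (path 5) i j ≟ᵇ true) →-dec (cycle₅-adj i j ≟ᵇ true)} tt

-- down from u to 0, then up to v
route : Fin 5 → Fin 5 → List (Fin 5)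
route u v = reverse (take (toℕ u) (allFin 5)) ++ take (toℕ v) (drop 1 (allFin 5))

path₅-connected : Connected (path 5)
path₅-connected u v = route u v , valid u v
  where
  valid : ∀ u v → IsWalk (path 5) (u ∷ route u v) × last u (route u v) ≡ v
  valid = toWitness {a? = all? λ u → all? λ v →
    IsWalk? (path 5) (u ∷ route u v) ×-dec (last u (route u v) ≟ᶠ v)} tt

unit : Weight 5
unit _ _ = 1ℚ

open import Data.Integer using (+_)

admissible⇒≤3/8 : ∀ c → Admissible c → c ≤ + 3 / 8
admissible⇒≤3/8 c admissible = *-cancelʳ-≤-pos (+ 4 / 1) (begin
  c * (+ 4 / 1)
    ≡⟨ solve 1 (λ c → c :* con (+ 4 / 1) := :- con (+ 5 / 2) :+ (con (+ 5 / 2) :+ c :* con (+ 4 / 1)))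
               refl c ⟩
  - (+ 5 / 2) + (+ 5 / 2 + c * (+ 4 / 1))
    ≤⟨ +-monoʳ-≤ (- (+ 5 / 2)) C₅-bound ⟩
  - (+ 5 / 2) + (+ 4 / 1)
    ≡⟨⟩
  (+ 3 / 8) * (+ 4 / 1)
    ∎)
  where
  open ≤-Reasoning
  -- w(C₅) = 5, w(P₅) = 4 and mac(C₅) = 4 hold by evaluation.
  C₅-bound : + 5 / 2 + c * (+ 4 / 1) ≤ + 4 / 1
  C₅-bound = admissible 5 cycle₅ unit (λ _ _ _ → nonNegative⁻¹ 1ℚ)
    (Connected-mono path₅⊆cycle₅ path₅-connected) cycle₅-triangleFree
    (path 5) (path₅⊆cycle₅ , path₅-connected , path-acyclic)

quarter-admissible : Admissible (+ 1 / 4)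
quarter-admissible zero    G w _   _ _  T _                   = ≤-refl
quarter-admissible (suc m) G w w≥0 _ tf T (T⊆G , tree) = begin
  + 1 / 2 * wt G w + + 1 / 4 * wt T w
    ≡⟨ solve 2 (λ g t → con ½ :* g :+ con (+ 1 / 4) :* t := con ½ :* (g :+ con ½ :* t))
               refl (wt G w) (wt T w) ⟩
  ½ * (wt G w + ½ * wt T w)
    ≤⟨ half-≤ (mac G w) (mac-lower-bound tf w≥0) ⟩
  mac G w
    ∎
  where
  open RootedCuts G T w T⊆G (tree-rooting tree)
  open ≤-Reasoning

proposition4p4 : Admissible (+ 1 / 4) × (∀ (c : ℚ) → Admissible c → c ≤ + 3 / 8)
proposition4p4 = quarter-admissible , admissible⇒≤3/8
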